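{- Let $p$ be an arbitrary partially ordered pattern of length $m$, let $k\ge1$, and let $\sigma=\sigma_1\cdots\sigma_k$ be a permutation of $[k]$. Let $p'$ be the partially ordered pattern of length $k+m$ obtained from $p$ by increasing each label by $k$ and adding a disjoint chain on the labels $1,\dots,k$ which, read from top to bottom, is $\sigma_1,\sigma_2,\dots,\sigma_k$ (i.e. the only relations among $1,\dots,k$ are $\sigma_1>\sigma_2>\cdots>\sigma_k$ and their transitive consequences, and no label in $[k]$ is comparable with a label in $[k+1,k+m]$). Let $C(x)$, $A(x)$, $B(x)$ be the exponential generating functions for the numbers of permutations avoiding $p'$, the chain pattern $\sigma$ (the POP on $[k]$ given by the chain above), and $p$, respectively, and let $A^{\star}(x)$ be the exponential generating function for the number of permutations quasi-avoiding the chain pattern $\sigma$. Then $$C(x)=A(x)+B(x)A^{\star}(x).$$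
   Context: A partially ordered pattern (POP) of length $k$ is a poset on $[k]$; an occurrence of it in a permutation $\pi=\pi_1\cdots\pi_n$ is a subsequence $\pi_{i_1}\cdots\pi_{i_k}$ with $i_1<\cdots<i_k$ such that $\pi_{i_j}<\pi_{i_m}$ whenever $j<m$ in the poset; avoidance means having no occurrence. For a sequence $s$ of distinct numbers, $\mathrm{red}(s)$ replaces the $i$-th smallest entry by $i$. A permutation $\pi=\pi_1\cdots\pi_n$ quasi-avoids a POP $q$ if $\pi$ contains an occurrence of $q$ but $\mathrm{red}(\pi_1\cdots\pi_{n-1})$ does not. The exponential generating function of a sequence $c(n)$ is $\sum_{n\ge0}c(n)x^n/n!$. -}

module Defs where

open import Data.Nat as ℕ using (ℕ; zero; suc; _+_; _*_; _∸_)
open import Data.Nat.Properties using (_<?_)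
open import Data.Nat.Combinatorics using (_C_)
open import Data.Fin as Fin using (Fin; toℕ; splitAt)
open import Data.Fin.Properties using (any?; all?; _≟_) renaming (_<?_ to _<ᶠ?_)
open import Data.Fin.Permutation using (Permutation′; _⟨$⟩ˡ_)
open import Data.Vec as Vec using (Vec; []; _∷_; lookup)
open import Data.List as List using (List; length; filter)
open import Data.Nat.ListAction using (sum)
open import Data.Sum using (_⊎_; inj₁; inj₂)
open import Data.Product using (Σ; ∃; _×_; _,_)
open import Data.Empty using (⊥)
open import Relation.Nullary using (Dec; yes; no; ¬_)
open import Relation.Nullary.Decidable using (_×-dec_; _→-dec_; ¬?)
open import Relation.Binary using (Decidable)
open import Relation.Binary.PropositionalEquality using (_≡_)

-- A POP of length k is given by its (strict) order relation on the
-- labels Fin k = {0,…,k-1} (label i here = label i+1 in the paper),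
-- together with a decision procedure for it (needed to count).
-- Being a strict partial order is imposed as a hypothesis where needed.

record POP (k : ℕ) : Set₁ where
  field
    _≺_  : Fin k → Fin k → Set
    _≺?_ : Decidable _≺_

open POP public

Occ : ∀ {k m} → POP k → Vec ℕ m → Set
Occ {k} {m} q s =
  ∃ λ (ι : Vec (Fin m) k) →
      (∀ a b → a Fin.< b → lookup ι a Fin.< lookup ι b)
    × (∀ a b → _≺_ q a b → lookup s (lookup ι a) ℕ.< lookup s (lookup ι b))

∃Vec? : ∀ {n} k {P : Vec (Fin n) k → Set} → (∀ v → Dec (P v)) → Dec (∃ P)
∃Vec? zero P? with P? []
... | yes p = yes ([] , p)
... | no ¬p = no λ { ([] , p) → ¬p p }
∃Vec? (suc k) P? with any? (λ x → ∃Vec? k (λ v → P? (x ∷ v)))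
... | yes (x , v , p) = yes (x ∷ v , p)
... | no ¬e = no λ { (x ∷ v , p) → ¬e (x , v , p) }

Occ? : ∀ {k m} (q : POP k) (s : Vec ℕ m) → Dec (Occ q s)
Occ? {k} q s = ∃Vec? k λ ι →
    all? (λ a → all? (λ b → (a <ᶠ? b) →-dec (lookup ι a <ᶠ? lookup ι b)))
  ×-dec
    all? (λ a → all? (λ b → _≺?_ q a b →-dec
                      (lookup s (lookup ι a) <? lookup s (lookup ι b))))

-- Permutations of [n] are represented as words π₁⋯πₙ (vectors over
-- Fin n, values 0,…,n-1) with pairwise distinct entries.

IsPerm : ∀ {n} → Vec (Fin n) n → Set
IsPerm π = ∀ i j → lookup π i ≡ lookup π j → i ≡ j

IsPerm? : ∀ {n} (π : Vec (Fin n) n) → Dec (IsPerm π)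
IsPerm? π = all? λ i → all? λ j → (lookup π i ≟ lookup π j) →-dec (i ≟ j)

word : ∀ {n} → Vec (Fin n) n → Vec ℕ n
word = Vec.map toℕ

-- red(s): replace the i-th smallest entry by i (0-based: by the number
-- of entries smaller than it).
red : ∀ {m} → Vec ℕ m → Vec ℕ m
red s = Vec.map (λ x → Vec.count (λ y → y <? x) s) s

dropLast : ∀ {A : Set} {n} → Vec A n → Vec A (ℕ.pred n)
dropLast []       = []
dropLast (x ∷ xs) = Vec.init (x ∷ xs)

Avoids : ∀ {k n} → POP k → Vec (Fin n) n → Set
Avoids q π = ¬ Occ q (word π)

QuasiAvoids : ∀ {k n} → POP k → Vec (Fin n) n → Set
QuasiAvoids q π = Occ q (word π) × ¬ Occ q (red (dropLast (word π)))

allVecs : ∀ n k → List (Vec (Fin n) k)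
allVecs n zero    = List.[ [] ]
allVecs n (suc k) =
  List.concatMap (λ x → List.map (x ∷_) (allVecs n k)) (List.allFin n)

countPerms : ∀ n {P : Vec (Fin n) n → Set} → (∀ π → Dec (P π)) → ℕ
countPerms n P? = length (filter (λ π → IsPerm? π ×-dec P? π) (allVecs n n))

av : ∀ {k} → POP k → ℕ → ℕ
av q n = countPerms n (λ π → ¬? (Occ? q (word π)))

qav : ∀ {k} → POP k → ℕ → ℕ
qav q n = countPerms n (λ π → Occ? q (word π) ×-dec ¬? (Occ? q (red (dropLast (word π)))))

-- The chain pattern of σ = σ₁⋯σ_k (σ_i = σ ⟨$⟩ʳ i): σ₁ > σ₂ > ⋯ > σ_k,
-- i.e. x ≺ y iff y occurs before x in σ (σ⁻¹ y < σ⁻¹ x).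

chain : ∀ {k} → Permutation′ k → POP k
chain σ = record
  { _≺_  = λ x y → (σ ⟨$⟩ˡ y) Fin.< (σ ⟨$⟩ˡ x)
  ; _≺?_ = λ x y → (σ ⟨$⟩ˡ y) <ᶠ? (σ ⟨$⟩ˡ x) }

⊎Rel : ∀ {A B : Set} → (A → A → Set) → (B → B → Set) → A ⊎ B → A ⊎ B → Set
⊎Rel R S (inj₁ a) (inj₁ b) = R a b
⊎Rel R S (inj₁ a) (inj₂ b) = ⊥
⊎Rel R S (inj₂ a) (inj₁ b) = ⊥
⊎Rel R S (inj₂ a) (inj₂ b) = S a b

⊎Rel? : ∀ {A B : Set} {R : A → A → Set} {S : B → B → Set} →
        Decidable R → Decidable S → Decidable (⊎Rel R S)
⊎Rel? R? S? (inj₁ a) (inj₁ b) = R? a b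
⊎Rel? R? S? (inj₁ a) (inj₂ b) = no λ ()
⊎Rel? R? S? (inj₂ a) (inj₁ b) = no λ ()
⊎Rel? R? S? (inj₂ a) (inj₂ b) = S? a b

-- p' : labels 1..k (Fin k part, via splitAt) carry the chain of σ,
-- labels k+1..k+m carry p shifted by k; no cross relations.
extend : ∀ {k m} → Permutation′ k → POP m → POP (k + m)
extend {k} σ p = record
  { _≺_  = λ x y → ⊎Rel (_≺_ (chain σ)) (_≺_ p) (splitAt k x) (splitAt k y)
  ; _≺?_ = λ x y → ⊎Rel? (_≺?_ (chain σ)) (_≺?_ p) (splitAt k x) (splitAt k y) }

-- Binomial convolution = coefficient of xⁿ/n! in a product of EGFs:
-- n! [xⁿ] (F(x) G(x)) = Σ_{i=0}^{n} (n choose i) f(i) g(n-i).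

egfProd : (ℕ → ℕ) → (ℕ → ℕ) → ℕ → ℕ
egfProd f g n = sum (List.map (λ i → (n C i) * f i * g (n ∸ i)) (List.upTo (suc n)))

-- An occurrence of extend σ p is an occurrence of σ followed, in position, by an occurrence of p.
-- So a permutation avoiding σ avoids extend σ p, and a permutation π of length n containing σ
-- avoids it iff, for the least j such that π₁⋯π_j contains σ, the suffix π_{j+1}⋯π_n avoids p
-- (every occurrence of σ ends at or after position j). The prefix π₁⋯π_j is then exactly a word
-- quasi-avoiding σ. Both conditions only depend on the relative order of the entries of the prefix
-- and of the suffix, and a permutation is determined by the set of values in its suffix together
-- with its standardised prefix and suffix. Hence exactly C(n,l) · av p l · qav σ (n ∸ l)
-- permutations avoiding extend σ p but not σ have a suffix of length l.

module Submission where

open import Data.Nat as ℕ using (ℕ; zero; suc; _+_; _*_; _∸_; _≤_; _<_; z≤n; s≤s; _<?_; _!; NonZero)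
import Data.Nat.Properties as ℕₚ
open import Data.Nat.Properties using (_!*_!≢0)
open import Data.Nat.Combinatorics using (_C_; nCk≡n!/k![n-k]!; nCk≡nC[n∸k])
open import Data.Nat.DivMod using (_/_; m*n/n≡m)
open import Data.Nat.ListAction using (sum)
open import Algebra.Properties.CommutativeSemigroup ℕₚ.+-commutativeSemigroup
  using () renaming (interchange to +-interchange)
open import Data.Fin as Fin using (Fin; toℕ; fromℕ<; inject₁; punchIn; punchOut; splitAt; _↑ˡ_; _↑ʳ_)
import Data.Fin.Properties as Finₚ
open import Data.Fin.Permutation using (Permutation′)
open import Data.Vec as Vec using (Vec; []; _∷_; lookup; tabulate)
import Data.Vec.Properties as Vecₚ
open import Data.List as List using (List; []; _∷_; [_]; length; filter; map; _++_; cartesianProduct)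
import Data.List.Properties as Listₚ
open import Data.List.Membership.Propositional using (_∈_)
open import Data.List.Membership.Propositional.Properties
  using (∈-filter⁺; ∈-filter⁻; ∈-cartesianProduct⁺; ∈-cartesianProductWith⁺; ∈-allFin; ∈-upTo⁺; ∈-upTo⁻)
open import Data.List.Relation.Unary.Any using (here; there; _─_)
open import Data.List.Relation.Unary.All as All using ([]; _∷_)
open import Data.List.Relation.Unary.AllPairs using ([]; _∷_)
open import Data.List.Relation.Unary.Unique.Propositional using (Unique)
import Data.List.Relation.Unary.Unique.Propositional.Properties as Uniqueₚ
open import Data.Product using (∃; _×_; _,_; proj₁; proj₂)
open import Data.Sum using (inj₁; inj₂; [_,_]′)
open import Data.Unit using (tt)
open import Data.Empty using (⊥; ⊥-elim)
open import Function using (_∘_; id; _⇔_; mk⇔; Equivalence)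
open import Function.Construct.Composition using (_⇔-∘_)
open import Relation.Nullary using (Dec; yes; no; ¬_; contradiction)
open import Relation.Nullary.Decidable as Dec using (_×-dec_; _→-dec_; ¬?)
open import Relation.Unary using (Decidable; U; _≐_)
open import Relation.Unary.Properties using (U?; _∩?_; ∁?; _×?_)
open import Relation.Binary.Definitions using (tri<; tri≈; tri>)
open import Relation.Binary.PropositionalEquality
  using (_≡_; _≢_; refl; sym; trans; cong; cong₂; subst; subst₂; module ≡-Reasoning)
open import Relation.Binary.Structures using (IsStrictPartialOrder)
open import Defs

open Equivalence using (to; from)

-- Counting list elements with a decidable property

count : ∀ {A : Set} {P : A → Set} → Decidable P → List A → ℕ
count P? xs = length (filter P? xs)

module _ {A : Set} {P Q : A → Set} (P? : Decidable P) (Q? : Decidable Q) where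

  count-≐ : P ≐ Q → ∀ xs → count P? xs ≡ count Q? xs
  count-≐ P≐Q xs = cong length (Listₚ.filter-≐ P? Q? P≐Q xs)

  count-∩∁ : ∀ xs → count P? xs ≡ count (P? ∩? Q?) xs + count (P? ∩? ∁? Q?) xs
  count-∩∁ [] = refl
  count-∩∁ (x ∷ xs) with P? x | Q? x
  ... | yes _ | yes _ = cong suc (count-∩∁ xs)
  ... | yes _ | no  _ = trans (cong suc (count-∩∁ xs)) (sym (ℕₚ.+-suc _ _))
  ... | no  _ | _     = count-∩∁ xs

count-++ : ∀ {A : Set} {P : A → Set} (P? : Decidable P) xs ys →
           count P? (xs ++ ys) ≡ count P? xs + count P? ys
count-++ P? xs ys = trans (cong length (Listₚ.filter-++ P? xs ys)) (Listₚ.length-++ (filter P? xs))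

module _ {A B : Set} {P : A → Set} {Q : B → Set} (P? : Decidable P) (Q? : Decidable Q) where

  private
    count-×-map : ∀ x ys → P x → count (P? ×? Q?) (map (x ,_) ys) ≡ count Q? ys
    count-×-map x []       _  = refl
    count-×-map x (y ∷ ys) px with P? x | Q? y
    ... | yes _ | yes _ = cong suc (count-×-map x ys px)
    ... | yes _ | no  _ = count-×-map x ys px
    ... | no ¬px | _    = contradiction px ¬px

    count-×-map-∁ : ∀ x ys → ¬ P x → count (P? ×? Q?) (map (x ,_) ys) ≡ 0
    count-×-map-∁ x []       _   = refl
    count-×-map-∁ x (y ∷ ys) ¬px with P? x
    ... | yes px = contradiction px ¬px
    ... | no  _  = count-×-map-∁ x ys ¬px

  count-cartesianProduct : ∀ xs ys →
    count (P? ×? Q?) (cartesianProduct xs ys) ≡ count P? xs * count Q? ys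
  count-cartesianProduct []       ys = refl
  count-cartesianProduct (x ∷ xs) ys = begin
    count (P? ×? Q?) (map (x ,_) ys ++ cartesianProduct xs ys)
      ≡⟨ count-++ (P? ×? Q?) (map (x ,_) ys) _ ⟩
    count (P? ×? Q?) (map (x ,_) ys) + count (P? ×? Q?) (cartesianProduct xs ys)
      ≡⟨ cong (_ +_) (count-cartesianProduct xs ys) ⟩
    count (P? ×? Q?) (map (x ,_) ys) + count P? xs * count Q? ys
      ≡⟨ head-row ⟩
    count P? (x ∷ xs) * count Q? ys ∎
    where
    open ≡-Reasoning
    head-row : count (P? ×? Q?) (map (x ,_) ys) + count P? xs * count Q? ys
             ≡ count P? (x ∷ xs) * count Q? ys
    head-row with P? x
    ... | yes px = cong (_+ _) (count-×-map x ys px)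
    ... | no ¬px = cong (_+ _) (count-×-map-∁ x ys ¬px)

∈-─ : ∀ {B : Set} {y w : B} {ys} (y∈ys : y ∈ ys) → w ∈ ys → w ≢ y → w ∈ (ys ─ y∈ys)
∈-─ (here refl)  (here refl)  w≢y = contradiction refl w≢y
∈-─ (here refl)  (there w∈ys) _   = w∈ys
∈-─ (there y∈ys) (here refl)  _   = here refl
∈-─ (there y∈ys) (there w∈ys) w≢y = there (∈-─ y∈ys w∈ys w≢y)

length-≤-injection : ∀ {A B : Set} (f : A → B) {xs : List A} {ys : List B} → Unique xs →
  (∀ {x x′} → x ∈ xs → x′ ∈ xs → f x ≡ f x′ → x ≡ x′) →
  (∀ {x} → x ∈ xs → f x ∈ ys) → length xs ≤ length ys
length-≤-injection f {[]}     _              _   _    = z≤n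
length-≤-injection f {x ∷ xs} {ys} (x∉xs ∷ u) inj into =
  subst (suc (length xs) ≤_) (sym (Listₚ.length-removeAt′ ys _))
    (s≤s (length-≤-injection f u (λ p q → inj (there p) (there q)) into′))
  where
  fx∈ys : f x ∈ ys
  fx∈ys = into (here refl)
  into′ : ∀ {x′} → x′ ∈ xs → f x′ ∈ (ys ─ fx∈ys)
  into′ {x′} x′∈xs = ∈-─ fx∈ys (into (there x′∈xs))
    (λ e → All.lookup x∉xs x′∈xs (sym (inj (there x′∈xs) (here refl) e)))

record Listing (A : Set) : Set where
  field
    elements : List A
    unique   : Unique elements
    complete : ∀ x → x ∈ elements

open Listing

module _ {A B : Set} (LA : Listing A) (LB : Listing B)
         {P : A → Set} {Q : B → Set} (P? : Decidable P) (Q? : Decidable Q) where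

  count-≤-injection : (f : A → B) (g : B → A) →
    (∀ x → P x → Q (f x)) → (∀ x → P x → g (f x) ≡ x) →
    count P? (elements LA) ≤ count Q? (elements LB)
  count-≤-injection f g P→Q g∘f =
    length-≤-injection f (Uniqueₚ.filter⁺ P? (unique LA))
      (λ {x} {x′} p p′ e → trans (sym (g∘f x (P-of p))) (trans (cong g e) (g∘f x′ (P-of p′))))
      (λ {x} p → ∈-filter⁺ Q? (complete LB _) (P→Q x (P-of p)))
    where
    P-of : ∀ {x} → x ∈ filter P? (elements LA) → P x
    P-of p = proj₂ (∈-filter⁻ P? {xs = elements LA} p)

count-bijection : ∀ {A B : Set} (LA : Listing A) (LB : Listing B)
  {P : A → Set} {Q : B → Set} (P? : Decidable P) (Q? : Decidable Q) (f : A → B) (g : B → A) →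
  (∀ x → P x → Q (f x)) → (∀ y → Q y → P (g y)) →
  (∀ x → P x → g (f x) ≡ x) → (∀ y → Q y → f (g y) ≡ y) →
  count P? (elements LA) ≡ count Q? (elements LB)
count-bijection LA LB P? Q? f g P→Q Q→P g∘f f∘g = ℕₚ.≤-antisym
  (count-≤-injection LA LB P? Q? f g P→Q g∘f)
  (count-≤-injection LB LA Q? P? g f Q→P f∘g)

Fin-listing : ∀ n → Listing (Fin n)
Fin-listing n = record
  { elements = List.allFin n ; unique = Uniqueₚ.allFin⁺ n ; complete = ∈-allFin }

count-allFin : ∀ n → count U? (List.allFin n) ≡ n
count-allFin n = trans (cong length (Listₚ.filter-all U? (All.universal (λ _ → tt) (List.allFin n))))
                       (Listₚ.length-tabulate {n = n} (λ x → x))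

×-listing : ∀ {A B : Set} → Listing A → Listing B → Listing (A × B)
×-listing LA LB = record
  { elements = cartesianProduct (elements LA) (elements LB)
  ; unique   = Uniqueₚ.cartesianProduct⁺ (unique LA) (unique LB)
  ; complete = λ (a , b) → ∈-cartesianProduct⁺ (complete LA a) (complete LB b) }

private
  concatMap-map : ∀ {A B C : Set} (f : A → B → C) (ys : List B) xs →
    List.concatMap (λ x → map (f x) ys) xs ≡ List.cartesianProductWith f xs ys
  concatMap-map f ys []       = refl
  concatMap-map f ys (x ∷ xs) = cong (map (f x) ys ++_) (concatMap-map f ys xs)

Vec-listing : ∀ n k → Listing (Vec (Fin n) k)
Vec-listing n k = record { elements = allVecs n k ; unique = unique′ k ; complete = complete′ }
  where
  unique′ : ∀ k → Unique (allVecs n k)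
  unique′ zero    = [] ∷ []
  unique′ (suc k) = subst Unique (sym (concatMap-map _∷_ (allVecs n k) (List.allFin n)))
    (Uniqueₚ.cartesianProductWith⁺ _∷_ Vecₚ.∷-injective (Uniqueₚ.allFin⁺ n) (unique′ k))
  complete′ : ∀ {k} (v : Vec (Fin n) k) → v ∈ allVecs n k
  complete′ []      = here refl
  complete′ (x ∷ v) = subst (x ∷ v ∈_) (sym (concatMap-map _∷_ (allVecs n _) (List.allFin n)))
    (∈-cartesianProductWith⁺ _∷_ (∈-allFin x) (complete′ v))

module _ {I A : Set} {D : I → A → Set} (D? : ∀ i → Decidable (D i))
         (D-disjoint : ∀ i i′ x → D i x → D i′ x → i ≡ i′) where

  private
    hits : A → List I → ℕ
    hits x is = sum (map (λ i → count (D? i) [ x ]) is)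

    hits-none : ∀ {x} is → (∀ {i} → i ∈ is → ¬ D i x) → hits x is ≡ 0
    hits-none []       _ = refl
    hits-none {x} (i ∷ is) ¬D with D? i x
    ... | yes d = contradiction d (¬D (here refl))
    ... | no  _ = hits-none is (¬D ∘ there)

    hits-one : ∀ {x i} {is} → Unique is → i ∈ is → D i x → hits x is ≡ 1
    hits-one {x} {is = i₀ ∷ is} (i₀∉is ∷ u) i∈ d with D? i₀ x
    ... | yes d₀ = cong suc (hits-none is
                    (λ {i′} i′∈is d′ → All.lookup i₀∉is i′∈is (D-disjoint i₀ i′ x d₀ d′)))
    hits-one (_ ∷ u) (here refl) d | no ¬d₀ = contradiction d ¬d₀
    hits-one (_ ∷ u) (there i∈)  d | no _   = hits-one u i∈ d

  count-partition : ∀ {R : A → Set} (R? : Decidable R) {is} → Unique is →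
    (∀ x → R x → ∃ λ i → i ∈ is × D i x) → (∀ i x → i ∈ is → D i x → R x) →
    ∀ xs → count R? xs ≡ sum (map (λ i → count (D? i) xs) is)
  count-partition R? {is} u cover sound [] = sym (sum-zeros is)
    where
    sum-zeros : ∀ js → sum (map (λ i → count (D? i) []) js) ≡ 0
    sum-zeros []       = refl
    sum-zeros (_ ∷ js) = sum-zeros js
  count-partition R? {is} u cover sound (x ∷ xs) = begin
    count R? ([ x ] ++ xs)
      ≡⟨ count-++ R? [ x ] xs ⟩
    count R? [ x ] + count R? xs
      ≡⟨ cong₂ _+_ here-x (count-partition R? u cover sound xs) ⟩
    hits x is + sum (map (λ i → count (D? i) xs) is)
      ≡⟨ sym (sum-map-+ is) ⟩
    sum (map (λ i → count (D? i) [ x ] + count (D? i) xs) is)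
      ≡⟨ cong sum (Listₚ.map-cong (λ i → sym (count-++ (D? i) [ x ] xs)) is) ⟩
    sum (map (λ i → count (D? i) (x ∷ xs)) is) ∎
    where
    open ≡-Reasoning
    here-x : count R? [ x ] ≡ hits x is
    here-x with R? x
    ... | yes r = let i , i∈ , d = cover x r in sym (hits-one u i∈ d)
    ... | no ¬r = sym (hits-none is (λ {i} i∈ d → ¬r (sound i x i∈ d)))
    sum-map-+ : ∀ js → sum (map (λ i → count (D? i) [ x ] + count (D? i) xs) js)
                     ≡ hits x js + sum (map (λ i → count (D? i) xs) js)
    sum-map-+ []       = refl
    sum-map-+ (j ∷ js) = trans (cong (_ +_) (sum-map-+ js))
                               (+-interchange (count (D? j) [ x ]) (count (D? j) xs) _ _)

-- Order isomorphism and standardisation of words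

lookup-ext : ∀ {A : Set} {n} {u v : Vec A n} → (∀ i → lookup u i ≡ lookup v i) → u ≡ v
lookup-ext {u = u} {v} h =
  trans (sym (Vecₚ.tabulate∘lookup u)) (trans (Vecₚ.tabulate-cong h) (Vecₚ.tabulate∘lookup v))

lookup-word : ∀ {n} (π : Vec (Fin n) n) i → lookup (word π) i ≡ toℕ (lookup π i)
lookup-word π i = Vecₚ.lookup-map i toℕ π

record SameOrder {m} (s t : Vec ℕ m) : Set where
  constructor sameOrder
  field
    preserves : ∀ a b → lookup s a < lookup s b → lookup t a < lookup t b
    reflects  : ∀ a b → lookup t a < lookup t b → lookup s a < lookup s b

open SameOrder

SameOrder-sym : ∀ {m} {s t : Vec ℕ m} → SameOrder s t → SameOrder t s
SameOrder-sym (sameOrder preserves reflects) = sameOrder reflects preserves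

Occ-resp-SameOrder : ∀ {k m} (q : POP k) {s t : Vec ℕ m} → SameOrder s t → Occ q s → Occ q t
Occ-resp-SameOrder q s∼t (ι , ι-mono , ι-pat) =
  ι , ι-mono , λ a b a≺b → preserves s∼t (lookup ι a) (lookup ι b) (ι-pat a b a≺b)

Distinct : ∀ {m} → Vec ℕ m → Set
Distinct s = ∀ a b → lookup s a ≡ lookup s b → a ≡ b

Distinct-resp-SameOrder : ∀ {m} {s t : Vec ℕ m} → SameOrder s t → Distinct s → Distinct t
Distinct-resp-SameOrder {s = s} s∼t s-distinct a b e with ℕₚ.<-cmp (lookup s a) (lookup s b)
... | tri< lt _ _ = contradiction e (ℕₚ.<⇒≢ (preserves s∼t a b lt))
... | tri≈ _ eq _ = s-distinct a b eq
... | tri> _ _ gt = contradiction (sym e) (ℕₚ.<⇒≢ (preserves s∼t b a gt))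

IsPerm⇒Distinct : ∀ {n} {π : Vec (Fin n) n} → IsPerm π → Distinct (word π)
IsPerm⇒Distinct {π = π} π-perm a b e =
  π-perm a b (Finₚ.toℕ-injective (trans (sym (lookup-word π a)) (trans e (lookup-word π b))))

Distinct⇒IsPerm : ∀ {n} {π : Vec (Fin n) n} → Distinct (word π) → IsPerm π
Distinct⇒IsPerm {π = π} distinct a b e =
  distinct a b (trans (lookup-word π a) (trans (cong toℕ e) (sym (lookup-word π b))))

module _ {P Q : ℕ → Set} (P? : Decidable P) (Q? : Decidable Q) where

  count-mono : ∀ {m} (s : Vec ℕ m) → (∀ i → P (lookup s i) → Q (lookup s i)) →
               Vec.count P? s ≤ Vec.count Q? s
  count-mono []      _   = z≤n
  count-mono (x ∷ s) P→Q with P? x | Q? x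
  ... | yes _ | yes _  = s≤s (count-mono s (P→Q ∘ Fin.suc))
  ... | yes p | no ¬q  = contradiction (P→Q Fin.zero p) ¬q
  ... | no  _ | yes _  = ℕₚ.m≤n⇒m≤1+n (count-mono s (P→Q ∘ Fin.suc))
  ... | no  _ | no  _  = count-mono s (P→Q ∘ Fin.suc)

  count-strictMono : ∀ {m} (s : Vec ℕ m) → (∀ i → P (lookup s i) → Q (lookup s i)) →
    ∀ j → ¬ P (lookup s j) → Q (lookup s j) → Vec.count P? s < Vec.count Q? s
  count-strictMono (x ∷ s) P→Q Fin.zero ¬p q with P? x | Q? x
  ... | yes p | _     = contradiction p ¬p
  ... | no  _ | yes _ = s≤s (count-mono s (P→Q ∘ Fin.suc))
  ... | no  _ | no ¬q = contradiction q ¬q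
  count-strictMono (x ∷ s) P→Q (Fin.suc j) ¬p q with P? x | Q? x
  ... | yes _ | yes _ = s≤s (count-strictMono s (P→Q ∘ Fin.suc) j ¬p q)
  ... | yes p | no ¬q = contradiction (P→Q Fin.zero p) ¬q
  ... | no  _ | yes _ = ℕₚ.m≤n⇒m≤1+n (count-strictMono s (P→Q ∘ Fin.suc) j ¬p q)
  ... | no  _ | no  _ = count-strictMono s (P→Q ∘ Fin.suc) j ¬p q

  count-cong : ∀ {m} (s t : Vec ℕ m) →
    (∀ i → (P (lookup s i) → Q (lookup t i)) × (Q (lookup t i) → P (lookup s i))) →
    Vec.count P? s ≡ Vec.count Q? t
  count-cong []      []      _   = refl
  count-cong (x ∷ s) (y ∷ t) P⇔Q with P? x | Q? y
  ... | yes _ | yes _ = cong suc (count-cong s t (P⇔Q ∘ Fin.suc))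
  ... | yes p | no ¬q = contradiction (proj₁ (P⇔Q Fin.zero) p) ¬q
  ... | no ¬p | yes q = contradiction (proj₂ (P⇔Q Fin.zero) q) ¬p
  ... | no  _ | no  _ = count-cong s t (P⇔Q ∘ Fin.suc)

count<length : ∀ {P : ℕ → Set} (P? : Decidable P) {m} (s : Vec ℕ m) →
               ∀ j → ¬ P (lookup s j) → Vec.count P? s < m
count<length P? (x ∷ s) Fin.zero ¬p with P? x
... | yes p = contradiction p ¬p
... | no  _ = s≤s (Vecₚ.count≤n P? s)
count<length P? (x ∷ s) (Fin.suc j) ¬p with P? x
... | yes _ = s≤s (count<length P? s j ¬p)
... | no  _ = ℕₚ.m≤n⇒m≤1+n (count<length P? s j ¬p)

rank : ∀ {m} → Vec ℕ m → ℕ → ℕ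
rank s x = Vec.count (_<? x) s

rank<length : ∀ {m} (s : Vec ℕ m) a → rank s (lookup s a) < m
rank<length s a = count<length (_<? lookup s a) s a (ℕₚ.<-irrefl refl)

lookup-red : ∀ {m} (s : Vec ℕ m) a → lookup (red s) a ≡ rank s (lookup s a)
lookup-red s a = Vecₚ.lookup-map a (rank s) s

SameOrder-red : ∀ {m} (s : Vec ℕ m) → SameOrder s (red s)
SameOrder-red s = sameOrder rank-< rank-<⁻¹
  where
  rank-< : ∀ a b → lookup s a < lookup s b → lookup (red s) a < lookup (red s) b
  rank-< a b lt = subst₂ _<_ (sym (lookup-red s a)) (sym (lookup-red s b))
    (count-strictMono _ _ s (λ _ l → ℕₚ.<-trans l lt) a (ℕₚ.<-irrefl refl) lt)
  rank-<⁻¹ : ∀ a b → lookup (red s) a < lookup (red s) b → lookup s a < lookup s b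
  rank-<⁻¹ a b lt = ℕₚ.≰⇒> λ sb≤sa → ℕₚ.<⇒≱ (subst₂ _<_ (lookup-red s a) (lookup-red s b) lt)
    (count-mono _ _ s (λ _ l → ℕₚ.<-≤-trans l sb≤sa))

red-resp-SameOrder : ∀ {m} {s t : Vec ℕ m} → SameOrder s t → red s ≡ red t
red-resp-SameOrder {s = s} {t} s∼t = lookup-ext λ a → begin
  lookup (red s) a       ≡⟨ lookup-red s a ⟩
  rank s (lookup s a)    ≡⟨ count-cong _ _ s t (λ i → preserves s∼t i a , reflects s∼t i a) ⟩
  rank t (lookup t a)    ≡⟨ lookup-red t a ⟨
  lookup (red t) a       ∎
  where open ≡-Reasoning

word-injective : ∀ {n} {u v : Vec (Fin n) n} → word u ≡ word v → u ≡ v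
word-injective {u = u} {v} e = lookup-ext λ i → Finₚ.toℕ-injective
  (trans (sym (lookup-word u i)) (trans (cong (λ w → lookup w i) e) (lookup-word v i)))

standardise : ∀ {m} → Vec ℕ m → Vec (Fin m) m
standardise s = tabulate λ a → fromℕ< (rank<length s a)

word-standardise : ∀ {m} (s : Vec ℕ m) → word (standardise s) ≡ red s
word-standardise s = lookup-ext λ a → begin
  lookup (word (standardise s)) a ≡⟨ lookup-word (standardise s) a ⟩
  toℕ (lookup (standardise s) a)  ≡⟨ cong toℕ (Vecₚ.lookup∘tabulate _ a) ⟩
  toℕ (fromℕ< (rank<length s a))  ≡⟨ Finₚ.toℕ-fromℕ< _ ⟩
  rank s (lookup s a)             ≡⟨ lookup-red s a ⟨
  lookup (red s) a                ∎
  where open ≡-Reasoning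

SameOrder-standardise : ∀ {m} (s : Vec ℕ m) → SameOrder s (word (standardise s))
SameOrder-standardise s rewrite word-standardise s = SameOrder-red s

standardise-resp-SameOrder : ∀ {m} {s t : Vec ℕ m} → SameOrder s t → standardise s ≡ standardise t
standardise-resp-SameOrder {s = s} {t} s∼t = word-injective
  (trans (word-standardise s) (trans (red-resp-SameOrder s∼t) (sym (word-standardise t))))

standardise-IsPerm : ∀ {m} (s : Vec ℕ m) → Distinct s → IsPerm (standardise s)
standardise-IsPerm s s-distinct =
  Distinct⇒IsPerm {π = standardise s} (Distinct-resp-SameOrder (SameOrder-standardise s) s-distinct)

perm-surjective : ∀ {j} (α : Vec (Fin j) j) → IsPerm α → ∀ r → ∃ λ a → lookup α a ≡ r
perm-surjective {suc j} α α-perm r with Finₚ.any? (λ a → lookup α a Finₚ.≟ r)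
... | yes hit = hit
... | no miss = contradiction (Finₚ.injective⇒≤ punchOut-injective) ℕₚ.1+n≰n
  where
  α≢r : ∀ a → r ≢ lookup α a
  α≢r a e = miss (a , sym e)
  punchOut-injective : ∀ {a b} → punchOut (α≢r a) ≡ punchOut (α≢r b) → a ≡ b
  punchOut-injective {a} {b} e = α-perm a b (Finₚ.punchOut-injective (α≢r a) (α≢r b) e)

-- The fallback value r is never used when α is a permutation.
inverse : ∀ {j} → Vec (Fin j) j → Fin j → Fin j
inverse α r with Finₚ.any? (λ a → lookup α a Finₚ.≟ r)
... | yes (a , _) = a
... | no  _       = r

lookup-inverse : ∀ {j} (α : Vec (Fin j) j) → IsPerm α → ∀ r → lookup α (inverse α r) ≡ r
lookup-inverse α α-perm r with Finₚ.any? (λ a → lookup α a Finₚ.≟ r)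
... | yes (_ , e) = e
... | no  miss    = contradiction (perm-surjective α α-perm r) miss

inverse-lookup : ∀ {j} (α : Vec (Fin j) j) → IsPerm α → ∀ a → inverse α (lookup α a) ≡ a
inverse-lookup α α-perm a with Finₚ.any? (λ a′ → lookup α a′ Finₚ.≟ lookup α a)
... | yes (a′ , e) = α-perm a′ a e
... | no  miss     = contradiction (a , refl) miss

Increasing : ∀ {j} → (Fin j → ℕ) → Set
Increasing h = ∀ a b → a Fin.< b → h a < h b

Increasing? : ∀ {j} (h : Fin j → ℕ) → Dec (Increasing h)
Increasing? h = Finₚ.all? λ a → Finₚ.all? λ b → (a Finₚ.<? b) →-dec (h a ℕₚ.<? h b)

private
  increasing⇒toℕ≤ : ∀ {j} (h : Fin j → ℕ) → Increasing h → ∀ a → toℕ a ≤ h a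
  increasing⇒toℕ≤ h h-inc Fin.zero    = z≤n
  increasing⇒toℕ≤ {suc j} h h-inc (Fin.suc a) = ℕₚ.≤-<-trans
    (increasing⇒toℕ≤ (h ∘ inject₁) (λ x y lt → h-inc (inject₁ x) (inject₁ y)
       (subst₂ _<_ (sym (Finₚ.toℕ-inject₁ x)) (sym (Finₚ.toℕ-inject₁ y)) lt)) a)
    (h-inc (inject₁ a) (Fin.suc a) (s≤s (ℕₚ.≤-reflexive (Finₚ.toℕ-inject₁ a))))

  -- γ ∘ α⁻¹ is increasing, so it dominates the identity.
  preserves⇒≤ : ∀ {j} (α γ : Vec (Fin j) j) → IsPerm α →
    (∀ a b → lookup (word α) a < lookup (word α) b → lookup (word γ) a < lookup (word γ) b) →
    ∀ a → lookup (word α) a ≤ lookup (word γ) a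
  preserves⇒≤ α γ α-perm α<⇒γ< a = subst₂ _≤_
    (sym (lookup-word α a))
    (cong (lookup (word γ)) (inverse-lookup α α-perm a))
    (increasing⇒toℕ≤ (lookup (word γ) ∘ inverse α)
      (λ r r′ lt → α<⇒γ< _ _ (subst₂ _<_ (sym (word-inverse r)) (sym (word-inverse r′)) lt))
      (lookup α a))
    where
    word-inverse : ∀ r → lookup (word α) (inverse α r) ≡ toℕ r
    word-inverse r = trans (lookup-word α _) (cong toℕ (lookup-inverse α α-perm r))

SameOrder⇒≡ : ∀ {j} {α γ : Vec (Fin j) j} → IsPerm α → IsPerm γ →
              SameOrder (word α) (word γ) → α ≡ γ
SameOrder⇒≡ {α = α} {γ} α-perm γ-perm α∼γ = word-injective (lookup-ext λ a → ℕₚ.≤-antisym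
  (preserves⇒≤ α γ α-perm (preserves α∼γ) a) (preserves⇒≤ γ α γ-perm (reflects α∼γ) a))

standardise-word : ∀ {j} {α : Vec (Fin j) j} → IsPerm α → standardise (word α) ≡ α
standardise-word {α = α} α-perm = SameOrder⇒≡
  (standardise-IsPerm (word α) (IsPerm⇒Distinct {π = α} α-perm)) α-perm
  (SameOrder-sym (SameOrder-standardise (word α)))

lookup-init : ∀ {A : Set} {m} (s : Vec A (suc m)) a → lookup (Vec.init s) a ≡ lookup s (inject₁ a)
lookup-init (x ∷ y ∷ s) Fin.zero    = refl
lookup-init (x ∷ y ∷ s) (Fin.suc a) = lookup-init (y ∷ s) a

SameOrder-dropLast : ∀ {m} {s t : Vec ℕ m} → SameOrder s t → SameOrder (dropLast s) (dropLast t)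
SameOrder-dropLast {s = []}    {[]}    _   = sameOrder (λ ()) (λ ())
SameOrder-dropLast {s = x ∷ s} {y ∷ t} s∼t = sameOrder
  (λ a b lt → restrict (y ∷ t) a b (preserves s∼t (inject₁ a) (inject₁ b) (unrestrict (x ∷ s) a b lt)))
  (λ a b lt → restrict (x ∷ s) a b (reflects s∼t (inject₁ a) (inject₁ b) (unrestrict (y ∷ t) a b lt)))
  where
  restrict : ∀ {m} (u : Vec ℕ (suc m)) a b → lookup u (inject₁ a) < lookup u (inject₁ b) →
             lookup (Vec.init u) a < lookup (Vec.init u) b
  restrict u a b = subst₂ _<_ (sym (lookup-init u a)) (sym (lookup-init u b))
  unrestrict : ∀ {m} (u : Vec ℕ (suc m)) a b → lookup (Vec.init u) a < lookup (Vec.init u) b →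
               lookup u (inject₁ a) < lookup u (inject₁ b)
  unrestrict u a b = subst₂ _<_ (lookup-init u a) (lookup-init u b)

-- Counting permutations

module _ (n : ℕ) where

  private
    N : ℕ
    N = suc n

    -- The junk value zero is only taken at the removed entry itself.
    squeeze : Fin (suc N) → Fin (suc N) → Fin N
    squeeze v x with v Finₚ.≟ x
    ... | yes _   = Fin.zero
    ... | no  v≢x = punchOut v≢x

    punchIn-squeeze : ∀ v x → v ≢ x → punchIn v (squeeze v x) ≡ x
    punchIn-squeeze v x v≢x with v Finₚ.≟ x
    ... | yes v≡x = contradiction v≡x v≢x
    ... | no  v≢x = Finₚ.punchIn-punchOut v≢x

    squeeze-punchIn : ∀ v y → squeeze v (punchIn v y) ≡ y
    squeeze-punchIn v y with v Finₚ.≟ punchIn v y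
    ... | yes v≡ = contradiction (sym v≡) (Finₚ.punchInᵢ≢i v y)
    ... | no  _  = trans (Finₚ.punchOut-cong v refl) (Finₚ.punchOut-punchIn v)

    split : Vec (Fin (suc N)) (suc N) → Fin (suc N) × Vec (Fin N) N
    split (v ∷ t) = v , Vec.map (squeeze v) t

    join : Fin (suc N) × Vec (Fin N) N → Vec (Fin (suc N)) (suc N)
    join (v , τ) = v ∷ Vec.map (punchIn v) τ

    squeeze-lookup : ∀ v (t : Vec (Fin (suc N)) N) i →
                     lookup (Vec.map (squeeze v) t) i ≡ squeeze v (lookup t i)
    squeeze-lookup v t i = Vecₚ.lookup-map i (squeeze v) t

    punchIn-lookup : ∀ v (τ : Vec (Fin N) N) i →
                     lookup (Vec.map (punchIn v) τ) i ≡ punchIn v (lookup τ i)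
    punchIn-lookup v τ i = Vecₚ.lookup-map i (punchIn v) τ

    head≢tail : ∀ {v} {t : Vec (Fin (suc N)) N} → IsPerm (v ∷ t) → ∀ i → v ≢ lookup t i
    head≢tail π-perm i e = contradiction (π-perm Fin.zero (Fin.suc i) e) λ ()

    split-IsPerm : ∀ π → IsPerm π → U (proj₁ (split π)) × IsPerm (proj₂ (split π))
    split-IsPerm (v ∷ t) π-perm = tt , λ i i′ e → Finₚ.suc-injective (π-perm (Fin.suc i) (Fin.suc i′) (begin
      lookup t i                            ≡⟨ punchIn-squeeze v _ (head≢tail π-perm i) ⟨
      punchIn v (squeeze v (lookup t i))    ≡⟨ cong (punchIn v) (trans (sym (squeeze-lookup v t i))
                                                 (trans e (squeeze-lookup v t i′))) ⟩
      punchIn v (squeeze v (lookup t i′))   ≡⟨ punchIn-squeeze v _ (head≢tail π-perm i′) ⟩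
      lookup t i′                           ∎))
      where open ≡-Reasoning

    join-IsPerm : ∀ z → U (proj₁ z) × IsPerm (proj₂ z) → IsPerm (join z)
    join-IsPerm (v , τ) _ Fin.zero Fin.zero _ = refl
    join-IsPerm (v , τ) _ Fin.zero (Fin.suc i) e =
      contradiction (sym (trans e (punchIn-lookup v τ i))) (Finₚ.punchInᵢ≢i v (lookup τ i))
    join-IsPerm (v , τ) _ (Fin.suc i) Fin.zero e =
      contradiction (trans (sym (punchIn-lookup v τ i)) e) (Finₚ.punchInᵢ≢i v (lookup τ i))
    join-IsPerm (v , τ) (_ , τ-perm) (Fin.suc i) (Fin.suc i′) e = cong Fin.suc (τ-perm i i′
      (Finₚ.punchIn-injective v _ _ (trans (sym (punchIn-lookup v τ i)) (trans e (punchIn-lookup v τ i′)))))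

    join∘split : ∀ π → IsPerm π → join (split π) ≡ π
    join∘split (v ∷ t) π-perm = cong (v ∷_) (lookup-ext λ i →
      trans (punchIn-lookup v (Vec.map (squeeze v) t) i) (trans (cong (punchIn v) (squeeze-lookup v t i))
        (punchIn-squeeze v _ (head≢tail π-perm i))))

    split∘join : ∀ z → U (proj₁ z) × IsPerm (proj₂ z) → split (join z) ≡ z
    split∘join (v , τ) _ = cong (v ,_) (lookup-ext λ i →
      trans (squeeze-lookup v (Vec.map (punchIn v) τ) i)
        (trans (cong (squeeze v) (punchIn-lookup v τ i)) (squeeze-punchIn v _)))

  count-IsPerm-suc : count IsPerm? (allVecs (suc N) (suc N)) ≡ suc N * count IsPerm? (allVecs N N)
  count-IsPerm-suc = begin
    count IsPerm? (allVecs (suc N) (suc N))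
      ≡⟨ count-bijection (Vec-listing (suc N) (suc N)) (×-listing (Fin-listing (suc N)) (Vec-listing N N))
           IsPerm? (U? ×? IsPerm?) split join split-IsPerm join-IsPerm join∘split split∘join ⟩
    count (U? ×? IsPerm?) (cartesianProduct (List.allFin (suc N)) (allVecs N N))
      ≡⟨ count-cartesianProduct U? IsPerm? (List.allFin (suc N)) (allVecs N N) ⟩
    count U? (List.allFin (suc N)) * count IsPerm? (allVecs N N)
      ≡⟨ cong (_* count IsPerm? (allVecs N N)) (count-allFin (suc N)) ⟩
    suc N * count IsPerm? (allVecs N N) ∎
    where open ≡-Reasoning

count-IsPerm : ∀ n → count IsPerm? (allVecs n n) ≡ n !
count-IsPerm zero          = refl
count-IsPerm (suc zero)    = refl
count-IsPerm (suc (suc n)) =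
  trans (count-IsPerm-suc n) (cong (suc (suc n) *_) (count-IsPerm (suc n)))

countPerms-universal : ∀ n {P : Vec (Fin n) n → Set} (P? : Decidable P) → (∀ π → P π) →
                       countPerms n P? ≡ n !
countPerms-universal n P? all-P =
  trans (count-≐ _ IsPerm? (proj₁ , λ {π} π-perm → π-perm , all-P π) (allVecs n n)) (count-IsPerm n)

-- Occurrences of a pattern within a window of positions

-- Past the end of s, entry s i is 0.
entry : ∀ {m} → Vec ℕ m → ℕ → ℕ
entry []       _       = 0
entry (x ∷ _)  zero    = x
entry (_ ∷ xs) (suc i) = entry xs i

entry-lookup : ∀ {m} (s : Vec ℕ m) i → entry s (toℕ i) ≡ lookup s i
entry-lookup (x ∷ s) Fin.zero    = refl
entry-lookup (x ∷ s) (Fin.suc i) = entry-lookup s i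

entry-tabulate : ∀ {m} (h : Fin m → ℕ) {i} (i<m : i < m) → entry (tabulate h) i ≡ h (fromℕ< i<m)
entry-tabulate {suc m} h {zero}  _         = refl
entry-tabulate {suc m} h {suc i} (s≤s i<m) = entry-tabulate (h ∘ Fin.suc) i<m

slice : ∀ {m} (lo len : ℕ) → Vec ℕ m → Vec ℕ len
slice lo len s = tabulate λ a → entry s (lo + toℕ a)

lookup-slice : ∀ {m} lo len (s : Vec ℕ m) a → lookup (slice lo len s) a ≡ entry s (lo + toℕ a)
lookup-slice lo len s a = Vecₚ.lookup∘tabulate _ a

entry-slice : ∀ {m} lo len (s : Vec ℕ m) {i} → i < len → entry (slice lo len s) i ≡ entry s (lo + i)
entry-slice lo len s i<len =
  trans (entry-tabulate _ i<len) (cong (entry s ∘ (lo +_)) (Finₚ.toℕ-fromℕ< i<len))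

dropLast-slice : ∀ {m} lo len (s : Vec ℕ m) → dropLast (slice lo len s) ≡ slice lo (ℕ.pred len) s
dropLast-slice lo zero      s = refl
dropLast-slice lo (suc len) s = lookup-ext λ a → begin
  lookup (Vec.init (slice lo (suc len) s)) a ≡⟨ lookup-init (slice lo (suc len) s) a ⟩
  lookup (slice lo (suc len) s) (inject₁ a)  ≡⟨ lookup-slice lo (suc len) s (inject₁ a) ⟩
  entry s (lo + toℕ (inject₁ a))             ≡⟨ cong (entry s ∘ (lo +_)) (Finₚ.toℕ-inject₁ a) ⟩
  entry s (lo + toℕ a)                       ≡⟨ lookup-slice lo len s a ⟨
  lookup (slice lo len s) a                  ∎
  where open ≡-Reasoning

record OccIn {k} (q : POP k) (f : ℕ → ℕ) (lo hi : ℕ) : Set where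
  field
    pos       : Fin k → ℕ
    pos-mono  : ∀ a b → a Fin.< b → pos a < pos b
    lo≤pos    : ∀ a → lo ≤ pos a
    pos<hi    : ∀ a → pos a < hi
    pos-order : ∀ a b → _≺_ q a b → f (pos a) < f (pos b)

open OccIn

module _ {k} (q : POP k) where

  OccIn-cong : ∀ {f g lo hi} → (∀ i → lo ≤ i → i < hi → f i ≡ g i) → OccIn q f lo hi → OccIn q g lo hi
  OccIn-cong {f} {g} f≡g o = record
    { pos = pos o ; pos-mono = pos-mono o ; lo≤pos = lo≤pos o ; pos<hi = pos<hi o
    ; pos-order = λ a b a≺b → subst₂ _<_ (eq a) (eq b) (pos-order o a b a≺b) }
    where
    eq : ∀ a → f (pos o a) ≡ g (pos o a)
    eq a = f≡g (pos o a) (lo≤pos o a) (pos<hi o a)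

  OccIn-widen : ∀ {f lo hi lo′ hi′} → lo′ ≤ lo → hi ≤ hi′ → OccIn q f lo hi → OccIn q f lo′ hi′
  OccIn-widen lo′≤lo hi≤hi′ o = record
    { pos = pos o ; pos-mono = pos-mono o ; pos-order = pos-order o
    ; lo≤pos = λ a → ℕₚ.≤-trans lo′≤lo (lo≤pos o a)
    ; pos<hi = λ a → ℕₚ.<-≤-trans (pos<hi o a) hi≤hi′ }

  OccIn-shift : ∀ {f} d {len} → OccIn q (f ∘ (d +_)) 0 len ⇔ OccIn q f d (d + len)
  OccIn-shift {f} d {len} = mk⇔ shift unshift
    where
    shift : OccIn q (f ∘ (d +_)) 0 len → OccIn q f d (d + len)
    shift o = record
      { pos       = (d +_) ∘ pos o
      ; pos-mono  = λ a b lt → ℕₚ.+-monoʳ-< d (pos-mono o a b lt)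
      ; lo≤pos    = λ a → ℕₚ.m≤m+n d (pos o a)
      ; pos<hi    = λ a → ℕₚ.+-monoʳ-< d (pos<hi o a)
      ; pos-order = pos-order o }
    unshift : OccIn q f d (d + len) → OccIn q (f ∘ (d +_)) 0 len
    unshift o = record
      { pos       = λ a → pos o a ∸ d
      ; pos-mono  = λ a b lt → ℕₚ.∸-monoˡ-< (pos-mono o a b lt) (lo≤pos o a)
      ; lo≤pos    = λ _ → z≤n
      ; pos<hi    = λ a → ℕₚ.<-≤-trans (ℕₚ.∸-monoˡ-< (pos<hi o a) (lo≤pos o a))
                                        (ℕₚ.≤-reflexive (ℕₚ.m+n∸m≡n d len))
      ; pos-order = λ a b a≺b → subst₂ _<_ (restore a) (restore b) (pos-order o a b a≺b) }
      where
      restore : ∀ a → f (pos o a) ≡ f (d + (pos o a ∸ d))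
      restore a = cong f (sym (ℕₚ.m+[n∸m]≡n (lo≤pos o a)))

  Occ⇔OccIn : ∀ {m} (s : Vec ℕ m) → Occ q s ⇔ OccIn q (entry s) 0 m
  Occ⇔OccIn {m} s = mk⇔ occIn occ
    where
    occIn : Occ q s → OccIn q (entry s) 0 m
    occIn (ι , ι-mono , ι-order) = record
      { pos       = toℕ ∘ lookup ι
      ; pos-mono  = ι-mono
      ; lo≤pos    = λ _ → z≤n
      ; pos<hi    = Finₚ.toℕ<n ∘ lookup ι
      ; pos-order = λ a b a≺b → subst₂ _<_ (sym (entry-lookup s _)) (sym (entry-lookup s _))
                                         (ι-order a b a≺b) }
    occ : OccIn q (entry s) 0 m → Occ q s
    occ o = ι , (λ a b lt → subst₂ _<_ (sym (toℕ-ι a)) (sym (toℕ-ι b)) (pos-mono o a b lt))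
               , λ a b a≺b → subst₂ _<_ (lookup-ι a) (lookup-ι b) (pos-order o a b a≺b)
      where
      ι : Vec (Fin m) k
      ι = tabulate λ a → fromℕ< (pos<hi o a)
      toℕ-ι : ∀ a → toℕ (lookup ι a) ≡ pos o a
      toℕ-ι a = trans (cong toℕ (Vecₚ.lookup∘tabulate _ a)) (Finₚ.toℕ-fromℕ< (pos<hi o a))
      lookup-ι : ∀ a → entry s (pos o a) ≡ lookup s (lookup ι a)
      lookup-ι a = trans (cong (entry s) (sym (toℕ-ι a))) (entry-lookup s _)

  Occ-slice⇔OccIn : ∀ {m} lo len (s : Vec ℕ m) → Occ q (slice lo len s) ⇔ OccIn q (entry s) lo (lo + len)
  Occ-slice⇔OccIn lo len s =
    OccIn-shift lo ⇔-∘ (entries ⇔-∘ Occ⇔OccIn (slice lo len s))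
    where
    eq : ∀ i → 0 ≤ i → i < len → entry (slice lo len s) i ≡ entry s (lo + i)
    eq i _ = entry-slice lo len s
    entries : OccIn q (entry (slice lo len s)) 0 len ⇔ OccIn q (entry s ∘ (lo +_)) 0 len
    entries = mk⇔ (OccIn-cong eq) (OccIn-cong λ i 0≤i i<len → sym (eq i 0≤i i<len))

pos-mono-≤ : ∀ {k q f lo hi} (o : OccIn {k} q f lo hi) a b → a Fin.≤ b → pos o a ≤ pos o b
pos-mono-≤ o a b a≤b with ℕₚ.m≤n⇒m<n∨m≡n a≤b
... | inj₁ a<b = ℕₚ.<⇒≤ (pos-mono o a b a<b)
... | inj₂ a≡b = ℕₚ.≤-reflexive (cong (pos o) (Finₚ.toℕ-injective a≡b))

-- Shuffling a prefix and a suffix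

OrderInvariant : ∀ {m} → (Vec ℕ m → Set) → Set
OrderInvariant P = ∀ {s t} → SameOrder s t → P s → P t

SameOrder-word-∘increasing : ∀ {j} {α : Vec (Fin j) j} {h : Fin j → ℕ} (t : Vec ℕ j) →
  Increasing h → (∀ a → lookup t a ≡ h (lookup α a)) → SameOrder (word α) t
SameOrder-word-∘increasing {α = α} {h} t h-inc t≡h∘α = sameOrder α<⇒t< t<⇒α<
  where
  α<⇒t< : ∀ a b → lookup (word α) a < lookup (word α) b → lookup t a < lookup t b
  α<⇒t< a b lt = subst₂ _<_ (sym (t≡h∘α a)) (sym (t≡h∘α b))
    (h-inc _ _ (subst₂ _<_ (lookup-word α a) (lookup-word α b) lt))
  t<⇒α< : ∀ a b → lookup t a < lookup t b → lookup (word α) a < lookup (word α) b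
  t<⇒α< a b lt with Finₚ.<-cmp (lookup α a) (lookup α b)
  ... | tri< αa<αb _ _ = subst₂ _<_ (sym (lookup-word α a)) (sym (lookup-word α b)) αa<αb
  ... | tri≈ _ αa≡αb _ = contradiction (trans (t≡h∘α a) (trans (cong h αa≡αb) (sym (t≡h∘α b))))
                                       (ℕₚ.<⇒≢ lt)
  ... | tri> _ _ αb<αa = contradiction (subst₂ _<_ (sym (t≡h∘α b)) (sym (t≡h∘α a)) (h-inc _ _ αb<αa))
                                       (ℕₚ.<-asym lt)

increasing-∘inverse : ∀ {j} {α : Vec (Fin j) j} (t : Vec ℕ j) → IsPerm α →
  SameOrder t (word α) → Increasing (lookup t ∘ inverse α)
increasing-∘inverse {α = α} t α-perm t∼α a b a<b =
  reflects t∼α _ _ (subst₂ _<_ (sym (word-inverse a)) (sym (word-inverse b)) a<b)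
  where
  word-inverse : ∀ r → lookup (word α) (inverse α r) ≡ toℕ r
  word-inverse r = trans (lookup-word α _) (cong toℕ (lookup-inverse α α-perm r))

reindex : ∀ {A : Set} {n} → Vec A n → (Fin n → Fin n) → Vec A n
reindex ρ h = tabulate (lookup ρ ∘ h)

lookup-reindex : ∀ {A : Set} {n} (ρ : Vec A n) h i → lookup (reindex ρ h) i ≡ lookup ρ (h i)
lookup-reindex ρ h i = Vecₚ.lookup∘tabulate (lookup ρ ∘ h) i

reindex-IsPerm : ∀ {n} (ρ : Vec (Fin n) n) {h : Fin n → Fin n} (h′ : Fin n → Fin n) →
  (∀ i → h′ (h i) ≡ i) → IsPerm ρ → IsPerm (reindex ρ h)
reindex-IsPerm ρ {h} h′ h′∘h ρ-perm i i′ e = begin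
  i        ≡⟨ h′∘h i ⟨
  h′ (h i)  ≡⟨ cong h′ (ρ-perm _ _ (trans (sym (lookup-reindex ρ h i)) (trans e (lookup-reindex ρ h i′)))) ⟩
  h′ (h i′) ≡⟨ h′∘h i′ ⟩
  i′       ∎
  where open ≡-Reasoning

reindex-reindex : ∀ {A : Set} {n} (ρ : Vec A n) {h h′ : Fin n → Fin n} →
  (∀ i → h′ (h i) ≡ i) → reindex (reindex ρ h′) h ≡ ρ
reindex-reindex ρ {h} {h′} h′∘h = lookup-ext λ i →
  trans (lookup-reindex (reindex ρ h′) h i) (trans (lookup-reindex ρ h′ (h i)) (cong (lookup ρ) (h′∘h i)))

module Shuffle (j l : ℕ) where

  prefix : Vec (Fin (j + l)) (j + l) → Vec ℕ j
  prefix π = slice 0 j (word π)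

  suffix : Vec (Fin (j + l)) (j + l) → Vec ℕ l
  suffix π = slice j l (word π)

  lookup-prefix : ∀ π a → lookup (prefix π) a ≡ toℕ (lookup π (a ↑ˡ l))
  lookup-prefix π a = begin
    lookup (prefix π) a           ≡⟨ lookup-slice 0 j (word π) a ⟩
    entry (word π) (toℕ a)        ≡⟨ cong (entry (word π)) (Finₚ.toℕ-↑ˡ a l) ⟨
    entry (word π) (toℕ (a ↑ˡ l)) ≡⟨ entry-lookup (word π) (a ↑ˡ l) ⟩
    lookup (word π) (a ↑ˡ l)      ≡⟨ lookup-word π (a ↑ˡ l) ⟩
    toℕ (lookup π (a ↑ˡ l))       ∎
    where open ≡-Reasoning

  lookup-suffix : ∀ π b → lookup (suffix π) b ≡ toℕ (lookup π (j ↑ʳ b))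
  lookup-suffix π b = begin
    lookup (suffix π) b           ≡⟨ lookup-slice j l (word π) b ⟩
    entry (word π) (j + toℕ b)    ≡⟨ cong (entry (word π)) (Finₚ.toℕ-↑ʳ j b) ⟨
    entry (word π) (toℕ (j ↑ʳ b)) ≡⟨ entry-lookup (word π) (j ↑ʳ b) ⟩
    lookup (word π) (j ↑ʳ b)      ≡⟨ lookup-word π (j ↑ʳ b) ⟩
    toℕ (lookup π (j ↑ʳ b))       ∎
    where open ≡-Reasoning

  _⊕_ : (Fin j → Fin j) → (Fin l → Fin l) → Fin (j + l) → Fin (j + l)
  (f ⊕ g) i = [ (λ a → f a ↑ˡ l) , (λ b → j ↑ʳ g b) ]′ (splitAt j i)

  ⊕-↑ˡ : ∀ f g a → (f ⊕ g) (a ↑ˡ l) ≡ f a ↑ˡ l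
  ⊕-↑ˡ f g a rewrite Finₚ.splitAt-↑ˡ j a l = refl

  ⊕-↑ʳ : ∀ f g b → (f ⊕ g) (j ↑ʳ b) ≡ j ↑ʳ g b
  ⊕-↑ʳ f g b rewrite Finₚ.splitAt-↑ʳ j l b = refl

  ⊕-inverse : ∀ {f f′ g g′} → (∀ a → f′ (f a) ≡ a) → (∀ b → g′ (g b) ≡ b) →
              ∀ i → (f′ ⊕ g′) ((f ⊕ g) i) ≡ i
  ⊕-inverse {f} {f′} {g} {g′} f′∘f g′∘g i with splitAt j i in eq
  ... | inj₁ a = trans (⊕-↑ˡ f′ g′ (f a)) (trans (cong (_↑ˡ l) (f′∘f a)) (Finₚ.splitAt⁻¹-↑ˡ eq))
  ... | inj₂ b = trans (⊕-↑ʳ f′ g′ (g b)) (trans (cong (j ↑ʳ_) (g′∘g b)) (Finₚ.splitAt⁻¹-↑ʳ eq))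

  prefix-reindex : ∀ ρ f g a → lookup (prefix (reindex ρ (f ⊕ g))) a ≡ lookup (prefix ρ) (f a)
  prefix-reindex ρ f g a = begin
    lookup (prefix (reindex ρ (f ⊕ g))) a      ≡⟨ lookup-prefix (reindex ρ (f ⊕ g)) a ⟩
    toℕ (lookup (reindex ρ (f ⊕ g)) (a ↑ˡ l))  ≡⟨ cong toℕ (lookup-reindex ρ (f ⊕ g) (a ↑ˡ l)) ⟩
    toℕ (lookup ρ ((f ⊕ g) (a ↑ˡ l)))          ≡⟨ cong (toℕ ∘ lookup ρ) (⊕-↑ˡ f g a) ⟩
    toℕ (lookup ρ (f a ↑ˡ l))                  ≡⟨ lookup-prefix ρ (f a) ⟨
    lookup (prefix ρ) (f a)                    ∎
    where open ≡-Reasoning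

  suffix-reindex : ∀ ρ f g b → lookup (suffix (reindex ρ (f ⊕ g))) b ≡ lookup (suffix ρ) (g b)
  suffix-reindex ρ f g b = begin
    lookup (suffix (reindex ρ (f ⊕ g))) b      ≡⟨ lookup-suffix (reindex ρ (f ⊕ g)) b ⟩
    toℕ (lookup (reindex ρ (f ⊕ g)) (j ↑ʳ b))  ≡⟨ cong toℕ (lookup-reindex ρ (f ⊕ g) (j ↑ʳ b)) ⟩
    toℕ (lookup ρ ((f ⊕ g) (j ↑ʳ b)))          ≡⟨ cong (toℕ ∘ lookup ρ) (⊕-↑ʳ f g b) ⟩
    toℕ (lookup ρ (j ↑ʳ g b))                  ≡⟨ lookup-suffix ρ (g b) ⟨
    lookup (suffix ρ) (g b)                    ∎
    where open ≡-Reasoning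

  IsShuffle : Vec (Fin (j + l)) (j + l) → Set
  IsShuffle ρ = IsPerm ρ × Increasing (lookup (prefix ρ)) × Increasing (lookup (suffix ρ))

  IsShuffle? : Decidable IsShuffle
  IsShuffle? ρ = IsPerm? ρ ×-dec Increasing? (lookup (prefix ρ)) ×-dec Increasing? (lookup (suffix ρ))

  prefix-Distinct : ∀ π → IsPerm π → Distinct (prefix π)
  prefix-Distinct π π-perm a a′ e = Finₚ.↑ˡ-injective l a a′ (π-perm _ _ (Finₚ.toℕ-injective
    (trans (sym (lookup-prefix π a)) (trans e (lookup-prefix π a′)))))

  suffix-Distinct : ∀ π → IsPerm π → Distinct (suffix π)
  suffix-Distinct π π-perm b b′ e = Finₚ.↑ʳ-injective j b b′ (π-perm _ _ (Finₚ.toℕ-injective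
    (trans (sym (lookup-suffix π b)) (trans e (lookup-suffix π b′)))))

  module _ {P : Vec ℕ j → Set} {Q : Vec ℕ l → Set} (P? : Decidable P) (Q? : Decidable Q)
           (P-invariant : OrderInvariant P) (Q-invariant : OrderInvariant Q) where

    private
      Triple : Set
      Triple = Vec (Fin (j + l)) (j + l) × Vec (Fin j) j × Vec (Fin l) l

      Splits : Vec (Fin (j + l)) (j + l) → Set
      Splits π = IsPerm π × P (prefix π) × Q (suffix π)

      Splits? : Decidable Splits
      Splits? = IsPerm? ∩? λ π → P? (prefix π) ×-dec Q? (suffix π)

      Shuffles : Triple → Set
      Shuffles (ρ , α , β) = IsShuffle ρ × (IsPerm α × P (word α)) × (IsPerm β × Q (word β))

      Shuffles? : Decidable Shuffles
      Shuffles? = IsShuffle? ×? ((IsPerm? ∩? (P? ∘ word)) ×? (IsPerm? ∩? (Q? ∘ word)))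

      unshuffle : Vec (Fin (j + l)) (j + l) → Triple
      unshuffle π = reindex π (inverse (standardise (prefix π)) ⊕ inverse (standardise (suffix π)))
                  , standardise (prefix π) , standardise (suffix π)

      shuffle : Triple → Vec (Fin (j + l)) (j + l)
      shuffle (ρ , α , β) = reindex ρ (lookup α ⊕ lookup β)

      unshuffle-sound : ∀ π → Splits π → Shuffles (unshuffle π)
      unshuffle-sound π (π-perm , Pπ , Qπ) =
        (reindex-IsPerm π (lookup α ⊕ lookup β)
           (⊕-inverse (lookup-inverse α α-perm) (lookup-inverse β β-perm)) π-perm
          , increasing-prefix , increasing-suffix)
        , (α-perm , P-invariant (SameOrder-standardise (prefix π)) Pπ)
        , (β-perm , Q-invariant (SameOrder-standardise (suffix π)) Qπ)
        where
        α : Vec (Fin j) j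
        α = standardise (prefix π)
        β : Vec (Fin l) l
        β = standardise (suffix π)
        α-perm : IsPerm α
        α-perm = standardise-IsPerm (prefix π) (prefix-Distinct π π-perm)
        β-perm : IsPerm β
        β-perm = standardise-IsPerm (suffix π) (suffix-Distinct π π-perm)
        ρ : Vec (Fin (j + l)) (j + l)
        ρ = reindex π (inverse α ⊕ inverse β)
        increasing-prefix : Increasing (lookup (prefix ρ))
        increasing-prefix a a′ a<a′ = subst₂ _<_
          (sym (prefix-reindex π (inverse α) (inverse β) a))
          (sym (prefix-reindex π (inverse α) (inverse β) a′))
          (increasing-∘inverse (prefix π) α-perm (SameOrder-standardise (prefix π)) a a′ a<a′)
        increasing-suffix : Increasing (lookup (suffix ρ))
        increasing-suffix b b′ b<b′ = subst₂ _<_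
          (sym (suffix-reindex π (inverse α) (inverse β) b))
          (sym (suffix-reindex π (inverse α) (inverse β) b′))
          (increasing-∘inverse (suffix π) β-perm (SameOrder-standardise (suffix π)) b b′ b<b′)

      SameOrder-prefix : ∀ ρ α β → Increasing (lookup (prefix ρ)) →
                         SameOrder (word α) (prefix (shuffle (ρ , α , β)))
      SameOrder-prefix ρ α β ρ-inc =
        SameOrder-word-∘increasing _ ρ-inc (prefix-reindex ρ (lookup α) (lookup β))

      SameOrder-suffix : ∀ ρ α β → Increasing (lookup (suffix ρ)) →
                         SameOrder (word β) (suffix (shuffle (ρ , α , β)))
      SameOrder-suffix ρ α β ρ-inc =
        SameOrder-word-∘increasing _ ρ-inc (suffix-reindex ρ (lookup α) (lookup β))

      shuffle-sound : ∀ z → Shuffles z → Splits (shuffle z)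
      shuffle-sound (ρ , α , β) ((ρ-perm , ρ-incˡ , ρ-incʳ) , (α-perm , Pα) , (β-perm , Qβ)) =
          reindex-IsPerm ρ (inverse α ⊕ inverse β)
            (⊕-inverse (inverse-lookup α α-perm) (inverse-lookup β β-perm)) ρ-perm
        , P-invariant (SameOrder-prefix ρ α β ρ-incˡ) Pα
        , Q-invariant (SameOrder-suffix ρ α β ρ-incʳ) Qβ

      shuffle∘unshuffle : ∀ π → Splits π → shuffle (unshuffle π) ≡ π
      shuffle∘unshuffle π (π-perm , _) = reindex-reindex π
        (⊕-inverse (inverse-lookup _ (standardise-IsPerm (prefix π) (prefix-Distinct π π-perm)))
                   (inverse-lookup _ (standardise-IsPerm (suffix π) (suffix-Distinct π π-perm))))

      unshuffle∘shuffle : ∀ z → Shuffles z → unshuffle (shuffle z) ≡ z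
      unshuffle∘shuffle (ρ , α , β) ((_ , ρ-incˡ , ρ-incʳ) , (α-perm , _) , (β-perm , _)) =
        restandardise
          (trans (standardise-resp-SameOrder (SameOrder-sym (SameOrder-prefix ρ α β ρ-incˡ)))
                 (standardise-word α-perm))
          (trans (standardise-resp-SameOrder (SameOrder-sym (SameOrder-suffix ρ α β ρ-incʳ)))
                 (standardise-word β-perm))
        where
        restandardise : ∀ {α′ β′} → α′ ≡ α → β′ ≡ β →
          (reindex (shuffle (ρ , α , β)) (inverse α′ ⊕ inverse β′) , α′ , β′) ≡ (ρ , α , β)
        restandardise refl refl = cong (_, α , β) (reindex-reindex ρ
          (⊕-inverse (lookup-inverse α α-perm) (lookup-inverse β β-perm)))

    count-shuffle : countPerms (j + l) (λ π → P? (prefix π) ×-dec Q? (suffix π))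
                  ≡ count IsShuffle? (allVecs (j + l) (j + l))
                    * (countPerms j (P? ∘ word) * countPerms l (Q? ∘ word))
    count-shuffle = begin
      count Splits? (allVecs (j + l) (j + l))
        ≡⟨ count-bijection (Vec-listing _ _)
             (×-listing (Vec-listing _ _) (×-listing (Vec-listing j j) (Vec-listing l l)))
             Splits? Shuffles? unshuffle shuffle
             unshuffle-sound shuffle-sound shuffle∘unshuffle unshuffle∘shuffle ⟩
      count Shuffles? (List.cartesianProduct (allVecs (j + l) (j + l))
                        (List.cartesianProduct (allVecs j j) (allVecs l l)))
        ≡⟨ count-cartesianProduct IsShuffle? _ (allVecs (j + l) (j + l)) _ ⟩
      count IsShuffle? (allVecs (j + l) (j + l))
        * count ((IsPerm? ∩? (P? ∘ word)) ×? (IsPerm? ∩? (Q? ∘ word)))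
                (List.cartesianProduct (allVecs j j) (allVecs l l))
        ≡⟨ cong (count IsShuffle? (allVecs (j + l) (j + l)) *_)
             (count-cartesianProduct (IsPerm? ∩? (P? ∘ word)) (IsPerm? ∩? (Q? ∘ word)) (allVecs j j) (allVecs l l)) ⟩
      count IsShuffle? (allVecs (j + l) (j + l)) * (countPerms j (P? ∘ word) * countPerms l (Q? ∘ word)) ∎
      where open ≡-Reasoning

  -- For trivial P and Q, count-shuffle says (j + l)! = S · j! · l!, with S the number of shuffles.
  count-IsShuffle : count IsShuffle? (allVecs (j + l) (j + l)) ≡ (j + l) C j
  count-IsShuffle = begin
    S                          ≡⟨ m*n/n≡m S d ⟨
    S * d / d                  ≡⟨ cong (_/ d) S*d≡[j+l]! ⟩
    (j + l) ! / d              ≡⟨ nCk≡n!/k![n-k]! (ℕₚ.m≤m+n j l) ⟨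
    (j + l) C j                ∎
    where
    open ≡-Reasoning
    S d : ℕ
    S = count IsShuffle? (allVecs (j + l) (j + l))
    d = j ! * (j + l ∸ j) !
    instance
      d≢0 : NonZero d
      d≢0 = j !* (j + l ∸ j) !≢0
    S*d≡[j+l]! : S * d ≡ (j + l) !
    S*d≡[j+l]! = begin
      S * d                            ≡⟨ cong (λ x → S * (j ! * x !)) (ℕₚ.m+n∸m≡n j l) ⟩
      S * (j ! * l !)
        ≡⟨ cong (S *_) (cong₂ _*_ (countPerms-universal j U? _) (countPerms-universal l U? _)) ⟨
      S * (countPerms j (U? ∘ word) * countPerms l (U? ∘ word))
        ≡⟨ count-shuffle U? U? (λ _ _ → tt) (λ _ _ → tt) ⟨
      countPerms (j + l) (λ π → U? (prefix π) ×-dec U? (suffix π))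
        ≡⟨ countPerms-universal (j + l) _ (λ _ → tt , tt) ⟩
      (j + l) !                        ∎

  countPerms-prefix-suffix : ∀ {P : Vec ℕ j → Set} {Q : Vec ℕ l → Set} (P? : Decidable P) (Q? : Decidable Q) →
    OrderInvariant P → OrderInvariant Q →
    countPerms (j + l) (λ π → P? (prefix π) ×-dec Q? (suffix π))
    ≡ ((j + l) C j) * (countPerms j (P? ∘ word) * countPerms l (Q? ∘ word))
  countPerms-prefix-suffix P? Q? P-invariant Q-invariant =
    trans (count-shuffle P? Q? P-invariant Q-invariant)
          (cong (_* (countPerms j (P? ∘ word) * countPerms l (Q? ∘ word))) count-IsShuffle)

-- Occurrences of the extended pattern

data SplitView (k m : ℕ) : Fin (k + m) → Set where
  left  : ∀ a → SplitView k m (a ↑ˡ m)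
  right : ∀ b → SplitView k m (k ↑ʳ b)

splitView : ∀ k {m} i → SplitView k m i
splitView k i with splitAt k i in eq
... | inj₁ a = subst (SplitView k _) (Finₚ.splitAt⁻¹-↑ˡ eq) (left a)
... | inj₂ b = subst (SplitView k _) (Finₚ.splitAt⁻¹-↑ʳ eq) (right b)

OccIn-empty : ∀ {k} (q : POP (suc k)) {f lo} → ¬ OccIn q f lo 0
OccIn-empty q o = ℕₚ.n≮0 (pos<hi o Fin.zero)

module _ {k m} (σ : Permutation′ k) (p : POP m) where

  private
    _≺ᶜ_ : Fin k → Fin k → Set
    _≺ᶜ_ = _≺_ (chain σ)
    _≺ᵖ_ : Fin m → Fin m → Set
    _≺ᵖ_ = _≺_ p
    _≺′_ : Fin (k + m) → Fin (k + m) → Set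
    _≺′_ = _≺_ (extend σ p)

  ≺-↑ˡ : ∀ a a′ → (a ↑ˡ m) ≺′ (a′ ↑ˡ m) ≡ a ≺ᶜ a′
  ≺-↑ˡ a a′ = cong₂ (⊎Rel _≺ᶜ_ _≺ᵖ_) (Finₚ.splitAt-↑ˡ k a m) (Finₚ.splitAt-↑ˡ k a′ m)

  ≺-↑ʳ : ∀ b b′ → (k ↑ʳ b) ≺′ (k ↑ʳ b′) ≡ b ≺ᵖ b′
  ≺-↑ʳ b b′ = cong₂ (⊎Rel _≺ᶜ_ _≺ᵖ_) (Finₚ.splitAt-↑ʳ k m b) (Finₚ.splitAt-↑ʳ k m b′)

  ≺-↑ˡ↑ʳ : ∀ a b → (a ↑ˡ m) ≺′ (k ↑ʳ b) ≡ ⊥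
  ≺-↑ˡ↑ʳ a b = cong₂ (⊎Rel _≺ᶜ_ _≺ᵖ_) (Finₚ.splitAt-↑ˡ k a m) (Finₚ.splitAt-↑ʳ k m b)

  ≺-↑ʳ↑ˡ : ∀ a b → (k ↑ʳ b) ≺′ (a ↑ˡ m) ≡ ⊥
  ≺-↑ʳ↑ˡ a b = cong₂ (⊎Rel _≺ᶜ_ _≺ᵖ_) (Finₚ.splitAt-↑ʳ k m b) (Finₚ.splitAt-↑ˡ k a m)

  OccIn-extend⁺ : ∀ {f lo t hi} → lo ≤ t → t ≤ hi →
                  OccIn (chain σ) f lo t → OccIn p f t hi → OccIn (extend σ p) f lo hi
  OccIn-extend⁺ {f} {lo} {t} {hi} lo≤t t≤hi oᶜ oᵖ = record
    { pos = position ; pos-mono = mono ; lo≤pos = above ; pos<hi = below ; pos-order = order }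
    where
    position : Fin (k + m) → ℕ
    position x = [ pos oᶜ , pos oᵖ ]′ (splitAt k x)
    position-↑ˡ : ∀ a → position (a ↑ˡ m) ≡ pos oᶜ a
    position-↑ˡ a rewrite Finₚ.splitAt-↑ˡ k a m = refl
    position-↑ʳ : ∀ b → position (k ↑ʳ b) ≡ pos oᵖ b
    position-↑ʳ b rewrite Finₚ.splitAt-↑ʳ k m b = refl

    mono : ∀ x y → x Fin.< y → position x < position y
    mono x y x<y with splitView k x | splitView k y
    ... | left a  | left a′  = subst₂ _<_ (sym (position-↑ˡ a)) (sym (position-↑ˡ a′))
      (pos-mono oᶜ a a′ (subst₂ _<_ (Finₚ.toℕ-↑ˡ a m) (Finₚ.toℕ-↑ˡ a′ m) x<y))
    ... | left a  | right b  = subst₂ _<_ (sym (position-↑ˡ a)) (sym (position-↑ʳ b))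
      (ℕₚ.<-≤-trans (pos<hi oᶜ a) (lo≤pos oᵖ b))
    ... | right b | left a   = ⊥-elim (ℕₚ.<-asym
      (subst₂ _<_ (Finₚ.toℕ-↑ʳ k b) (Finₚ.toℕ-↑ˡ a m) x<y)
      (ℕₚ.<-≤-trans (Finₚ.toℕ<n a) (ℕₚ.m≤m+n k (toℕ b))))
    ... | right b | right b′ = subst₂ _<_ (sym (position-↑ʳ b)) (sym (position-↑ʳ b′))
      (pos-mono oᵖ b b′ (ℕₚ.+-cancelˡ-< k _ _ (subst₂ _<_ (Finₚ.toℕ-↑ʳ k b) (Finₚ.toℕ-↑ʳ k b′) x<y)))

    above : ∀ x → lo ≤ position x
    above x with splitView k x
    ... | left a  = subst (lo ≤_) (sym (position-↑ˡ a)) (lo≤pos oᶜ a)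
    ... | right b = subst (lo ≤_) (sym (position-↑ʳ b)) (ℕₚ.≤-trans lo≤t (lo≤pos oᵖ b))

    below : ∀ x → position x < hi
    below x with splitView k x
    ... | left a  = subst (_< hi) (sym (position-↑ˡ a)) (ℕₚ.<-≤-trans (pos<hi oᶜ a) t≤hi)
    ... | right b = subst (_< hi) (sym (position-↑ʳ b)) (pos<hi oᵖ b)

    order : ∀ x y → x ≺′ y → f (position x) < f (position y)
    order x y x≺y with splitView k x | splitView k y
    ... | left a  | left a′  = subst₂ (λ u v → f u < f v) (sym (position-↑ˡ a)) (sym (position-↑ˡ a′))
      (pos-order oᶜ a a′ (subst id (≺-↑ˡ a a′) x≺y))
    ... | left a  | right b  = ⊥-elim (subst id (≺-↑ˡ↑ʳ a b) x≺y)
    ... | right b | left a   = ⊥-elim (subst id (≺-↑ʳ↑ˡ a b) x≺y)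
    ... | right b | right b′ = subst₂ (λ u v → f u < f v) (sym (position-↑ʳ b)) (sym (position-↑ʳ b′))
      (pos-order oᵖ b b′ (subst id (≺-↑ʳ b b′) x≺y))

module _ {k m} (σ : Permutation′ (suc k)) (p : POP m) where

  -- Cut right after the position of the last label of the chain.
  OccIn-extend⁻ : ∀ {f lo hi} → OccIn (extend σ p) f lo hi →
                  ∃ λ t → t ≤ hi × OccIn (chain σ) f lo t × OccIn p f t hi
  OccIn-extend⁻ {f} {lo} {hi} o = suc (pos o last) , pos<hi o last , oᶜ , oᵖ
    where
    last : Fin (suc k + m)
    last = Fin.fromℕ k ↑ˡ m
    oᶜ : OccIn (chain σ) f lo (suc (pos o last))
    oᶜ = record
      { pos       = pos o ∘ (_↑ˡ m)
      ; pos-mono  = λ a a′ a<a′ → pos-mono o _ _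
          (subst₂ _<_ (sym (Finₚ.toℕ-↑ˡ a m)) (sym (Finₚ.toℕ-↑ˡ a′ m)) a<a′)
      ; lo≤pos    = λ a → lo≤pos o (a ↑ˡ m)
      ; pos<hi    = λ a → s≤s (pos-mono-≤ o (a ↑ˡ m) last (subst₂ _≤_
          (sym (Finₚ.toℕ-↑ˡ a m)) (sym (Finₚ.toℕ-↑ˡ (Fin.fromℕ k) m))
          (subst (toℕ a ≤_) (sym (Finₚ.toℕ-fromℕ k)) (Finₚ.toℕ≤pred[n] a))))
      ; pos-order = λ a a′ a≺a′ → pos-order o _ _ (subst id (sym (≺-↑ˡ σ p a a′)) a≺a′) }
    oᵖ : OccIn p f (suc (pos o last)) hi
    oᵖ = record
      { pos       = pos o ∘ (suc k ↑ʳ_)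
      ; pos-mono  = λ b b′ b<b′ → pos-mono o _ _
          (subst₂ _<_ (sym (Finₚ.toℕ-↑ʳ (suc k) b)) (sym (Finₚ.toℕ-↑ʳ (suc k) b′))
            (ℕₚ.+-monoʳ-< (suc k) b<b′))
      ; lo≤pos    = λ b → pos-mono o last (suc k ↑ʳ b)
          (subst₂ _<_ (sym (Finₚ.toℕ-↑ˡ (Fin.fromℕ k) m)) (sym (Finₚ.toℕ-↑ʳ (suc k) b))
            (subst (_< suc k + toℕ b) (sym (Finₚ.toℕ-fromℕ k)) (s≤s (ℕₚ.m≤m+n k (toℕ b)))))
      ; pos<hi    = λ b → pos<hi o (suc k ↑ʳ b)
      ; pos-order = λ b b′ b≺b′ → pos-order o _ _ (subst id (sym (≺-↑ʳ σ p b b′)) b≺b′) }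

-- Cutting a permutation after its shortest prefix containing the chain

module _ {P : ℕ → Set} where

  rising-edge : (∀ n → Dec (P n)) → ¬ P 0 → ∀ {n} → P n → ∃ λ j → j ≤ n × P j × ¬ P (ℕ.pred j)
  rising-edge P? ¬P0 {zero}  P0 = contradiction P0 ¬P0
  rising-edge P? ¬P0 {suc n} Pn with P? n
  ... | no ¬Pn = suc n , ℕₚ.≤-refl , Pn , ¬Pn
  ... | yes Pn′ = let j , j≤n , Pj , ¬Pj′ = rising-edge P? ¬P0 Pn′ in j , ℕₚ.m≤n⇒m≤1+n j≤n , Pj , ¬Pj′

  rising-edge-unique : (∀ {i j} → i ≤ j → P i → P j) →
    ∀ {i j} → P i → ¬ P (ℕ.pred i) → P j → ¬ P (ℕ.pred j) → i ≡ j
  rising-edge-unique P-mono {i} {j} Pi ¬Pi′ Pj ¬Pj′ with ℕₚ.<-cmp i j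
  ... | tri< i<j _ _ = contradiction (P-mono (ℕₚ.<⇒≤pred i<j) Pi) ¬Pj′
  ... | tri≈ _ i≡j _ = i≡j
  ... | tri> _ _ j<i = contradiction (P-mono (ℕₚ.<⇒≤pred j<i) Pj) ¬Pi′

QuasiAvoidsWord : ∀ {k j} → POP k → Vec ℕ j → Set
QuasiAvoidsWord q s = Occ q s × ¬ Occ q (red (dropLast s))

QuasiAvoidsWord? : ∀ {k j} (q : POP k) → Decidable (QuasiAvoidsWord {j = j} q)
QuasiAvoidsWord? q s = Occ? q s ×-dec ¬? (Occ? q (red (dropLast s)))

QuasiAvoidsWord-invariant : ∀ {k j} (q : POP k) → OrderInvariant (QuasiAvoidsWord {j = j} q)
QuasiAvoidsWord-invariant q s∼t (occ , ¬occ′) = Occ-resp-SameOrder q s∼t occ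
  , subst (¬_ ∘ Occ q) (red-resp-SameOrder (SameOrder-dropLast s∼t)) ¬occ′

Avoids-invariant : ∀ {k j} (q : POP k) → OrderInvariant (λ (s : Vec ℕ j) → ¬ Occ q s)
Avoids-invariant q s∼t ¬occ = ¬occ ∘ Occ-resp-SameOrder q (SameOrder-sym s∼t)

Occ-red⇔Occ : ∀ {k j} (q : POP k) (s : Vec ℕ j) → Occ q (red s) ⇔ Occ q s
Occ-red⇔Occ q s = mk⇔ (Occ-resp-SameOrder q (SameOrder-sym (SameOrder-red s)))
                   (Occ-resp-SameOrder q (SameOrder-red s))

module _ {k m} (σ : Permutation′ (suc k)) (p : POP m) where

  RisingEdge : (ℕ → ℕ) → ℕ → Set
  RisingEdge f j = OccIn (chain σ) f 0 j × ¬ OccIn (chain σ) f 0 (ℕ.pred j)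

  RisingEdge-pos : ∀ {f j} → RisingEdge f j → 0 < j
  RisingEdge-pos {j = zero}  (o , _) = contradiction o (OccIn-empty (chain σ))
  RisingEdge-pos {j = suc j} _       = s≤s z≤n

  -- The chain part of an occurrence of extend σ p ends before j, contradicting minimality, or after it.
  Avoids-extend⇔ : ∀ {f j n} → RisingEdge f j → j ≤ n →
                   (¬ OccIn (extend σ p) f 0 n) ⇔ (¬ OccIn p f j n)
  Avoids-extend⇔ {f} {j} {n} (oᶜ , ¬oᶜ′) j≤n = mk⇔
    (λ ¬o′ oᵖ → ¬o′ (OccIn-extend⁺ σ p z≤n j≤n oᶜ oᵖ))
    (λ ¬oᵖ o′ → let t , _ , oᶜ″ , oᵖ″ = OccIn-extend⁻ σ p o′ in case t oᶜ″ oᵖ″ ¬oᵖ)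
    where
    case : ∀ t → OccIn (chain σ) f 0 t → OccIn p f t n → ¬ OccIn p f j n → ⊥
    case t oᶜ″ oᵖ″ ¬oᵖ with t ℕ.≤? ℕ.pred j
    ... | yes t≤j′ = ¬oᶜ′ (OccIn-widen (chain σ) ℕₚ.≤-refl t≤j′ oᶜ″)
    ... | no  t≰j′ = ¬oᵖ (OccIn-widen p (j≤t (RisingEdge-pos (oᶜ , ¬oᶜ′)) (ℕₚ.≰⇒> t≰j′)) ℕₚ.≤-refl oᵖ″)
      where
      j≤t : ∀ {j t} → 0 < j → ℕ.pred j < t → j ≤ t
      j≤t {suc _} _ lt = lt

  SplitsAt : ∀ {n} → ℕ → ℕ → Vec (Fin n) n → Set
  SplitsAt j l π = QuasiAvoidsWord (chain σ) (slice 0 j (word π)) × ¬ Occ p (slice j l (word π))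

  SplitsAt? : ∀ {n} j l → Decidable (SplitsAt {n} j l)
  SplitsAt? j l π = QuasiAvoidsWord? (chain σ) (slice 0 j (word π)) ×-dec ¬? (Occ? p (slice j l (word π)))

  QuasiAvoidsWord-prefix⇔ : ∀ {n} (s : Vec ℕ n) j →
    QuasiAvoidsWord (chain σ) (slice 0 j s) ⇔ RisingEdge (entry s) j
  QuasiAvoidsWord-prefix⇔ s j = mk⇔
    (λ (o , ¬o′) → to (Occ-slice⇔OccIn c 0 j s) o , ¬o′ ∘ from shorter)
    (λ (o , ¬o′) → from (Occ-slice⇔OccIn c 0 j s) o , ¬o′ ∘ to shorter)
    where
    c : POP (suc k)
    c = chain σ
    shorter : Occ c (red (dropLast (slice 0 j s))) ⇔ OccIn c (entry s) 0 (ℕ.pred j)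
    shorter = subst (λ t → Occ c (red t) ⇔ OccIn c (entry s) 0 (ℕ.pred j)) (sym (dropLast-slice 0 j s))
                    (Occ-slice⇔OccIn c 0 (ℕ.pred j) s ⇔-∘ Occ-red⇔Occ c (slice 0 (ℕ.pred j) s))

  SplitsAt⇔ : ∀ {n} (π : Vec (Fin n) n) j l → j + l ≡ n →
         SplitsAt j l π ⇔ (RisingEdge (entry (word π)) j × ¬ OccIn p (entry (word π)) j n)
  SplitsAt⇔ π j l refl = mk⇔
    (λ (qa , ¬o) → to (QuasiAvoidsWord-prefix⇔ (word π) j) qa , ¬o ∘ from (Occ-slice⇔OccIn p j l (word π)))
    (λ (e , ¬o) → from (QuasiAvoidsWord-prefix⇔ (word π) j) e , ¬o ∘ to (Occ-slice⇔OccIn p j l (word π)))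

  Occ-extend⇒Occ-chain : ∀ {n} (s : Vec ℕ n) → Occ (extend σ p) s → Occ (chain σ) s
  Occ-extend⇒Occ-chain s o′ with t , t≤n , oᶜ , _ ← OccIn-extend⁻ σ p (to (Occ⇔OccIn (extend σ p) s) o′)
    = from (Occ⇔OccIn (chain σ) s) (OccIn-widen (chain σ) ℕₚ.≤-refl t≤n oᶜ)

  count-SplitsAt : ∀ {n} j l → j + l ≡ n → countPerms n (SplitsAt? j l) ≡ (n C l) * av p l * qav (chain σ) j
  count-SplitsAt j l refl = begin
    countPerms (j + l) (SplitsAt? j l)
      ≡⟨ Shuffle.countPerms-prefix-suffix j l (QuasiAvoidsWord? (chain σ)) (¬? ∘ Occ? p)
           (QuasiAvoidsWord-invariant (chain σ)) (Avoids-invariant p) ⟩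
    ((j + l) C j) * (qav (chain σ) j * av p l)
      ≡⟨ cong₂ _*_ C-sym (ℕₚ.*-comm (qav (chain σ) j) (av p l)) ⟩
    ((j + l) C l) * (av p l * qav (chain σ) j)
      ≡⟨ ℕₚ.*-assoc ((j + l) C l) (av p l) (qav (chain σ) j) ⟨
    ((j + l) C l) * av p l * qav (chain σ) j ∎
    where
    open ≡-Reasoning
    C-sym : (j + l) C j ≡ (j + l) C l
    C-sym = trans (nCk≡nC[n∸k] (ℕₚ.m≤m+n j l)) (cong ((j + l) C_) (ℕₚ.m+n∸m≡n j l))

  Avoids-extend? : ∀ {n} → Decidable (λ (π : Vec (Fin n) n) → IsPerm π × ¬ Occ (extend σ p) (word π))
  Avoids-extend? = IsPerm? ∩? (¬? ∘ Occ? (extend σ p) ∘ word)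

  Occ-chain? : ∀ {n} → Decidable (λ (π : Vec (Fin n) n) → Occ (chain σ) (word π))
  Occ-chain? = Occ? (chain σ) ∘ word

  module _ (n : ℕ) where

    private
      InClass : ℕ → Vec (Fin n) n → Set
      InClass i π = IsPerm π × SplitsAt (n ∸ i) i π

      InClass? : ∀ i → Decidable (InClass i)
      InClass? i = IsPerm? ∩? SplitsAt? (n ∸ i) i

      InClass⇒≤ : ∀ {i} π → InClass i π → i ≤ n
      InClass⇒≤ {i} π (_ , (o , _) , _) = ℕₚ.<⇒≤ (ℕₚ.m∸n≢0⇒n<m λ n∸i≡0 →
        OccIn-empty (chain σ) (subst (OccIn (chain σ) _ 0) n∸i≡0
          (to (Occ-slice⇔OccIn (chain σ) 0 (n ∸ i) (word π)) o)))

      InClass-disjoint : ∀ i i′ π → InClass i π → InClass i′ π → i ≡ i′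
      InClass-disjoint i i′ π d@(_ , qa , _) d′@(_ , qa′ , _)
        with to (QuasiAvoidsWord-prefix⇔ (word π) (n ∸ i)) qa | to (QuasiAvoidsWord-prefix⇔ (word π) (n ∸ i′)) qa′
      ... | o , ¬o′ | o″ , ¬o‴ = ℕₚ.∸-cancelˡ-≡ (InClass⇒≤ π d) (InClass⇒≤ π d′)
        (rising-edge-unique (OccIn-widen (chain σ) ℕₚ.≤-refl) o ¬o′ o″ ¬o‴)

      OccIn-chain? : (π : Vec (Fin n) n) → ∀ j → Dec (OccIn (chain σ) (entry (word π)) 0 j)
      OccIn-chain? π j = Dec.map (Occ-slice⇔OccIn (chain σ) 0 j (word π)) (Occ? (chain σ) (slice 0 j (word π)))

      cover : ∀ π → (IsPerm π × ¬ Occ (extend σ p) (word π)) × Occ (chain σ) (word π) →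
              ∃ λ i → i ∈ List.upTo (suc n) × InClass i π
      cover π ((π-perm , ¬o′) , o)
        with j , j≤n , edge ← rising-edge (OccIn-chain? π) (OccIn-empty (chain σ))
                                  (to (Occ⇔OccIn (chain σ) (word π)) o)
        = n ∸ j , ∈-upTo⁺ (s≤s (ℕₚ.m∸n≤m n j)) , π-perm
        , from (SplitsAt⇔ π (n ∸ (n ∸ j)) (n ∸ j) (ℕₚ.m∸n+n≡m (ℕₚ.m∸n≤m n j)))
            (subst (RisingEdge (entry (word π))) (sym n∸[n∸j]≡j) edge
            , subst (λ t → ¬ OccIn p (entry (word π)) t n) (sym n∸[n∸j]≡j)
                (to (Avoids-extend⇔ edge j≤n) (¬o′ ∘ from (Occ⇔OccIn (extend σ p) (word π)))))
        where
        n∸[n∸j]≡j : n ∸ (n ∸ j) ≡ j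
        n∸[n∸j]≡j = ℕₚ.m∸[m∸n]≡n j≤n

      sound : ∀ i π → i ∈ List.upTo (suc n) → InClass i π →
              (IsPerm π × ¬ Occ (extend σ p) (word π)) × Occ (chain σ) (word π)
      sound i π _ (π-perm , cut)
        with edge@(o , _) , ¬oᵖ ← to (SplitsAt⇔ π (n ∸ i) i (ℕₚ.m∸n+n≡m (InClass⇒≤ π (π-perm , cut)))) cut
        = (π-perm , from (Avoids-extend⇔ edge (ℕₚ.m∸n≤m n i)) ¬oᵖ ∘ to (Occ⇔OccIn (extend σ p) (word π)))
        , from (Occ⇔OccIn (chain σ) (word π)) (OccIn-widen (chain σ) ℕₚ.≤-refl (ℕₚ.m∸n≤m n i) o)

    count-containing : count (Avoids-extend? ∩? Occ-chain?) (allVecs n n) ≡ egfProd (av p) (qav (chain σ)) n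
    count-containing = begin
      count (Avoids-extend? ∩? Occ-chain?) (allVecs n n)
        ≡⟨ count-partition InClass? InClass-disjoint (Avoids-extend? ∩? Occ-chain?)
             (Uniqueₚ.upTo⁺ (suc n)) cover sound (allVecs n n) ⟩
      sum (List.map (λ i → count (InClass? i) (allVecs n n)) (List.upTo (suc n)))
        ≡⟨ cong sum (Listₚ.map-cong-local (All.tabulate λ {i} i∈ →
             count-SplitsAt (n ∸ i) i (ℕₚ.m∸n+n≡m (ℕₚ.≤-pred (∈-upTo⁻ i∈))))) ⟩
      egfProd (av p) (qav (chain σ)) n ∎
      where open ≡-Reasoning

  count-avoiding : ∀ n → count (Avoids-extend? ∩? ∁? Occ-chain?) (allVecs n n) ≡ av (chain σ) n
  count-avoiding n = count-≐ _ _
    ((λ ((π-perm , _) , ¬o) → π-perm , ¬o)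
    , λ {π} (π-perm , ¬o) → (π-perm , ¬o ∘ Occ-extend⇒Occ-chain (word π)) , ¬o)
    (allVecs n n)

theorem17 : (m : ℕ) (p : POP m) → IsStrictPartialOrder _≡_ (POP._≺_ p) →
            (k : ℕ) → 1 ≤ k → (σ : Permutation′ k) →
            (n : ℕ) →
            av (extend σ p) n ≡ av (chain σ) n + egfProd (av p) (qav (chain σ)) n
theorem17 m p _ (suc k) _ σ n = begin
  av (extend σ p) n
    ≡⟨ count-∩∁ (Avoids-extend? σ p) (Occ-chain? σ p) (allVecs n n) ⟩
  count (Avoids-extend? σ p ∩? Occ-chain? σ p) (allVecs n n)
    + count (Avoids-extend? σ p ∩? ∁? (Occ-chain? σ p)) (allVecs n n)
    ≡⟨ cong₂ _+_ (count-containing σ p n) (count-avoiding σ p n) ⟩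
  egfProd (av p) (qav (chain σ)) n + av (chain σ) n
    ≡⟨ ℕₚ.+-comm _ (av (chain σ) n) ⟩
  av (chain σ) n + egfProd (av p) (qav (chain σ)) n ∎
  where open ≡-Reasoning
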